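{- Let $q,r$ be two different finite words of the same length and let $w$ be a proper overlap of $q$. Then $w$ has at most one occurrence of $r$ as a factor.
   Context: For a finite word $q$, an overlap of $q$ is a word $w$ having $q$ both as a prefix and as a suffix and such that $|q|<|w|\le 2|q|$. A proper overlap of $q$ is an overlap of $q$ which contains exactly two occurrences of $q$ as a factor. -}

module Defs where

open import Data.Nat using (ℕ; _<_; _≤_; _*_)
open import Data.List using (List; _++_; length)
open import Data.Product using (Σ; ∃; _×_; _,_)
open import Data.Sum using (_⊎_)
open import Relation.Binary.PropositionalEquality using (_≡_; _≢_)

OccursAt : {A : Set} → List A → List A → ℕ → Set
OccursAt {A} u w i = Σ (List A) λ x → Σ (List A) λ y → length x ≡ i × x ++ u ++ y ≡ w

IsPrefix : {A : Set} → List A → List A → Set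
IsPrefix {A} u w = Σ (List A) λ y → u ++ y ≡ w

IsSuffix : {A : Set} → List A → List A → Set
IsSuffix {A} u w = Σ (List A) λ x → x ++ u ≡ w

IsOverlap : {A : Set} → List A → List A → Set
IsOverlap q w = IsPrefix q w × IsSuffix q w × length q < length w × length w ≤ 2 * length q

ExactlyTwoOccurrences : {A : Set} → List A → List A → Set
ExactlyTwoOccurrences u w =
  Σ ℕ λ i → Σ ℕ λ j → i ≢ j × OccursAt u w i × OccursAt u w j ×
    (∀ k → OccursAt u w k → k ≡ i ⊎ k ≡ j)

IsProperOverlap : {A : Set} → List A → List A → Set
IsProperOverlap q w = IsOverlap q w × ExactlyTwoOccurrences q w

AtMostOneOccurrence : {A : Set} → List A → List A → Set
AtMostOneOccurrence u w = ∀ i j → OccursAt u w i → OccursAt u w j → i ≡ j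

-- Write n = |q|.  Since w is an overlap of q, q occurs in w at 0 and at p = |w| − n with
-- 0 < p ≤ n, so w has period p.  An occurrence of r at i satisfies i ≤ p, and 0 < i < p
-- because q ≠ r.  If r occurred at i and at i + D with D > 0, then the factor of length n
-- at i repeats D places later; propagating this through the period p shows that the
-- prefix q of w repeats D places later, i.e. q occurs at D with 0 < D < p: a third
-- occurrence of q, contradicting properness.
module Submission where

open import Defs
open import Data.Empty using (⊥; ⊥-elim)
open import Data.List using (List; []; _∷_; _++_; length; take; drop)
open import Data.List.Properties using (length-++; length-take; take++drop≡id; ++-identityʳ)
open import Data.Maybe using (Maybe; just; nothing)
open import Data.Maybe.Properties using (just-injective)
open import Data.Nat using (ℕ; zero; suc; _+_; _≤_; _<_; s≤s; _<?_)
open import Data.Nat.Properties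
open import Algebra.Properties.CommutativeSemigroup +-commutativeSemigroup
  using (x∙yz≈y∙xz; x∙yz≈yx∙z)
open import Data.Product using (Σ; _×_; _,_)
open import Data.Sum using (_⊎_; inj₁; inj₂)
open import Relation.Binary using (tri<; tri≈; tri>)
open import Relation.Binary.PropositionalEquality
  using (_≡_; _≢_; refl; sym; trans; cong; cong₂; subst; subst₂; module ≡-Reasoning)
open import Relation.Nullary using (¬_; yes; no)

open ≡-Reasoning

module _ {A : Set} where

  _‼_ : List A → ℕ → Maybe A
  []       ‼ _     = nothing
  (a ∷ _)  ‼ zero  = just a
  (_ ∷ as) ‼ suc k = as ‼ k

  ‼-++ʳ : (x y : List A) (k : ℕ) → (x ++ y) ‼ (length x + k) ≡ y ‼ k
  ‼-++ʳ []      y k = refl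
  ‼-++ʳ (_ ∷ x) y k = ‼-++ʳ x y k

  ‼-++ˡ : (x y : List A) {k : ℕ} → k < length x → (x ++ y) ‼ k ≡ x ‼ k
  ‼-++ˡ (_ ∷ x) y {zero}  _       = refl
  ‼-++ˡ (_ ∷ x) y {suc k} (s≤s k<) = ‼-++ˡ x y k<

  ‼-≥length : (u : List A) {k : ℕ} → length u ≤ k → u ‼ k ≡ nothing
  ‼-≥length []      _       = refl
  ‼-≥length (_ ∷ u) (s≤s le) = ‼-≥length u le

  ‼-take : (n : ℕ) (v : List A) {k : ℕ} → k < n → take n v ‼ k ≡ v ‼ k
  ‼-take (suc n) []      _                 = refl
  ‼-take (suc n) (_ ∷ v) {zero}  _         = refl
  ‼-take (suc n) (_ ∷ v) {suc k} (s≤s k<n) = ‼-take n v k<n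

  ‼-take-≥ : (n : ℕ) (v : List A) {k : ℕ} → n ≤ k → take n v ‼ k ≡ nothing
  ‼-take-≥ zero    v       _        = refl
  ‼-take-≥ (suc n) []      _        = refl
  ‼-take-≥ (suc n) (_ ∷ v) (s≤s n≤k) = ‼-take-≥ n v n≤k

  ‼-drop : (d : ℕ) (v : List A) (k : ℕ) → drop d v ‼ k ≡ v ‼ (d + k)
  ‼-drop zero    v       k = refl
  ‼-drop (suc d) []      k = refl
  ‼-drop (suc d) (_ ∷ v) k = ‼-drop d v k

  ‼-extensional : (u v : List A) → (∀ k → u ‼ k ≡ v ‼ k) → u ≡ v
  ‼-extensional []      []      _  = refl
  ‼-extensional []      (_ ∷ _) eq with eq 0
  ... | ()
  ‼-extensional (_ ∷ _) []      eq with eq 0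
  ... | ()
  ‼-extensional (a ∷ u) (b ∷ v) eq =
    cong₂ _∷_ (just-injective (eq 0)) (‼-extensional u v (λ k → eq (suc k)))

  ‼-extensional-< : (u v : List A) → length u ≡ length v →
                    (∀ k → k < length u → u ‼ k ≡ v ‼ k) → u ≡ v
  ‼-extensional-< u v |u|≡|v| eq = ‼-extensional u v eq′
    where
    eq′ : ∀ k → u ‼ k ≡ v ‼ k
    eq′ k with k <? length u
    ... | yes k< = eq k k<
    ... | no  k≮ = trans (‼-≥length u (≮⇒≥ k≮))
                         (sym (‼-≥length v (subst (_≤ k) |u|≡|v| (≮⇒≥ k≮))))

  OccursAt⇒‼ : {u w : List A} {i : ℕ} → OccursAt u w i →
               ∀ k → k < length u → w ‼ (i + k) ≡ u ‼ k
  OccursAt⇒‼ {u} (x , y , refl , refl) k k< = trans (‼-++ʳ x (u ++ y) k) (‼-++ˡ u y k<)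

  OccursAt⇒≤ : {u w : List A} {i : ℕ} → OccursAt u w i → i + length u ≤ length w
  OccursAt⇒≤ {u} (x , y , refl , refl) =
    subst (length x + length u ≤_)
      (sym (trans (length-++ x) (cong (length x +_) (length-++ u))))
      (+-monoʳ-≤ (length x) (m≤m+n (length u) (length y)))

  ‼⇒OccursAt : (u w : List A) (i : ℕ) → i + length u ≤ length w →
               (∀ k → k < length u → w ‼ (i + k) ≡ u ‼ k) → OccursAt u w i
  ‼⇒OccursAt u w i fits eq = take i w , drop (length u) (drop i w) , |take-i|≡i , split
    where
    |take-i|≡i : length (take i w) ≡ i
    |take-i|≡i = trans (length-take i w) (m≤n⇒m⊓n≡m (≤-trans (m≤m+n i (length u)) fits))

    window≡u : take (length u) (drop i w) ≡ u
    window≡u = ‼-extensional _ u window‼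
      where
      window‼ : ∀ k → take (length u) (drop i w) ‼ k ≡ u ‼ k
      window‼ k with k <? length u
      ... | yes k< = trans (‼-take (length u) (drop i w) k<) (trans (‼-drop i w k) (eq k k<))
      ... | no  k≮ = trans (‼-take-≥ (length u) (drop i w) (≮⇒≥ k≮))
                           (sym (‼-≥length u (≮⇒≥ k≮)))

    split : take i w ++ u ++ drop (length u) (drop i w) ≡ w
    split = begin
      take i w ++ u ++ drop (length u) (drop i w)
        ≡⟨ cong (λ z → take i w ++ z ++ drop (length u) (drop i w)) (sym window≡u) ⟩
      take i w ++ take (length u) (drop i w) ++ drop (length u) (drop i w)
        ≡⟨ cong (take i w ++_) (take++drop≡id (length u) (drop i w)) ⟩
      take i w ++ drop i w
        ≡⟨ take++drop≡id i w ⟩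
      w ∎

  occursAt-injective : {u v w : List A} {i : ℕ} → length u ≡ length v →
                       OccursAt u w i → OccursAt v w i → u ≡ v
  occursAt-injective {u} {v} |u|≡|v| ou ov = ‼-extensional-< u v |u|≡|v| λ k k< →
    trans (sym (OccursAt⇒‼ ou k k<)) (OccursAt⇒‼ ov k (subst (k <_) |u|≡|v| k<))

  exactlyTwo⇒≡⊎≡ : {u w : List A} {a b s : ℕ} → ExactlyTwoOccurrences u w →
                   OccursAt u w a → OccursAt u w b → a ≢ b → OccursAt u w s → s ≡ a ⊎ s ≡ b
  exactlyTwo⇒≡⊎≡ {a = a} {b} {s} (i , j , _ , _ , _ , only) oa ob a≢b os
    with only a oa | only b ob | only s os
  ... | inj₁ refl | inj₁ refl | _         = ⊥-elim (a≢b refl)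
  ... | inj₂ refl | inj₂ refl | _         = ⊥-elim (a≢b refl)
  ... | inj₁ refl | inj₂ refl | inj₁ refl = inj₁ refl
  ... | inj₁ refl | inj₂ refl | inj₂ refl = inj₂ refl
  ... | inj₂ refl | inj₁ refl | inj₁ refl = inj₂ refl
  ... | inj₂ refl | inj₁ refl | inj₂ refl = inj₁ refl

  SameFactor : List A → ℕ → ℕ → ℕ → Set
  SameFactor w a b n = ∀ k → k < n → w ‼ (a + k) ≡ w ‼ (b + k)

  -- Positions k ≥ i are reached directly from the repetition at i; positions k < i are
  -- first moved up by the period p into the window of that repetition.
  sameFactor-translate : (w : List A) {n p i D : ℕ} → p ≤ n → i + D < p →
                         SameFactor w p 0 n → SameFactor w (i + D) i n → SameFactor w D 0 n
  sameFactor-translate w {n} {p} {i} {D} p≤n i+D<p period repeat k k<n with k <? i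
  ... | no k≮i =
    let t , i+t≡k = m≤n⇒∃[o]m+o≡n (≮⇒≥ k≮i)
        t<n = ≤-<-trans (subst (t ≤_) i+t≡k (m≤n+m t i)) k<n
    in begin
      w ‼ (D + k)       ≡⟨ cong (λ z → w ‼ (D + z)) (sym i+t≡k) ⟩
      w ‼ (D + (i + t)) ≡⟨ cong (w ‼_) (x∙yz≈yx∙z D i t) ⟩
      w ‼ (i + D + t)   ≡⟨ repeat t t<n ⟩
      w ‼ (i + t)       ≡⟨ cong (w ‼_) i+t≡k ⟩
      w ‼ k             ∎
  ... | yes k<i =
    let i<p = ≤-<-trans (m≤m+n i D) i+D<p
        t , i+t≡p+k = m≤n⇒∃[o]m+o≡n (≤-trans (<⇒≤ i<p) (m≤m+n p k))
        t<n = +-cancelˡ-< i t n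
                (subst₂ _<_ (sym i+t≡p+k) (+-comm n i) (+-mono-≤-< p≤n k<i))
        k<n′ = <-≤-trans (<-trans k<i i<p) p≤n
        D+k<n = <-≤-trans (subst (D + k <_) (+-comm D i) (+-monoʳ-< D k<i))
                          (≤-trans (<⇒≤ i+D<p) p≤n)
    in begin
      w ‼ (D + k)           ≡⟨ sym (period (D + k) D+k<n) ⟩
      w ‼ (p + (D + k))     ≡⟨ cong (w ‼_) (x∙yz≈y∙xz p D k) ⟩
      w ‼ (D + (p + k))     ≡⟨ cong (λ z → w ‼ (D + z)) (sym i+t≡p+k) ⟩
      w ‼ (D + (i + t))     ≡⟨ cong (w ‼_) (x∙yz≈yx∙z D i t) ⟩
      w ‼ (i + D + t)       ≡⟨ repeat t t<n ⟩
      w ‼ (i + t)           ≡⟨ cong (w ‼_) i+t≡p+k ⟩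
      w ‼ (p + k)           ≡⟨ period k k<n′ ⟩
      w ‼ k                 ∎

  overlap⇒shift : {q w : List A} → IsOverlap q w →
                  Σ ℕ λ p → 0 < p × p ≤ length q × length w ≡ p + length q ×
                            OccursAt q w 0 × OccursAt q w p
  overlap⇒shift {q} {w} ((y , qy≡w) , (x , xq≡w) , |q|<|w| , |w|≤2|q|) =
    length x , 0<|x| , |x|≤|q| , |w|≡|x|+|q| , ([] , y , refl , qy≡w) ,
    (x , [] , refl , trans (cong (x ++_) (++-identityʳ q)) xq≡w)
    where
    |w|≡|x|+|q| : length w ≡ length x + length q
    |w|≡|x|+|q| = trans (cong length (sym xq≡w)) (length-++ x)

    |x|≤|q| : length x ≤ length q
    |x|≤|q| = +-cancelʳ-≤ (length q) (length x) (length q)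
      (subst₂ _≤_ |w|≡|x|+|q| (cong (length q +_) (+-identityʳ (length q))) |w|≤2|q|)

    0<|x| : 0 < length x
    0<|x| = n≢0⇒n>0 λ |x|≡0 →
      <-irrefl refl (subst (length q <_) (trans |w|≡|x|+|q| (cong (_+ length q) |x|≡0)) |q|<|w|)

  module Shift {q w : List A} {p : ℕ} (|w|≡p+|q| : length w ≡ p + length q)
               (q-at-0 : OccursAt q w 0) (q-at-p : OccursAt q w p) where

    occursAt⇒≤shift : {r : List A} {i : ℕ} → length q ≡ length r → OccursAt r w i → i ≤ p
    occursAt⇒≤shift {r} {i} |q|≡|r| or = +-cancelʳ-≤ (length q) i p
      (subst₂ (λ a b → i + a ≤ b) (sym |q|≡|r|) |w|≡p+|q| (OccursAt⇒≤ or))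

    occursAt⇒inside : {r : List A} {i : ℕ} → q ≢ r → length q ≡ length r →
                      OccursAt r w i → 0 < i × i < p
    occursAt⇒inside {r} {i} q≢r |q|≡|r| or = 0<i , i<p
      where
      not-at-q : ∀ {s} → OccursAt q w s → s ≢ i
      not-at-q oq refl = q≢r (occursAt-injective |q|≡|r| oq or)

      0<i : 0 < i
      0<i = n≢0⇒n>0 (λ i≡0 → not-at-q q-at-0 (sym i≡0))

      i<p : i < p
      i<p with m≤n⇒m<n∨m≡n (occursAt⇒≤shift |q|≡|r| or)
      ... | inj₁ i<p = i<p
      ... | inj₂ i≡p = ⊥-elim (not-at-q q-at-p (sym i≡p))

    repeat⇒occursAt : {r : List A} {i D : ℕ} → p ≤ length q → length q ≡ length r →
                      OccursAt r w i → OccursAt r w (i + D) → i + D < p → OccursAt q w D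
    repeat⇒occursAt {r} {i} {D} p≤|q| |q|≡|r| r-at-i r-at-i+D i+D<p =
      ‼⇒OccursAt q w D fits λ k k< →
        trans (sameFactor-translate w p≤|q| i+D<p period repeat k k<) (OccursAt⇒‼ q-at-0 k k<)
      where
      period : SameFactor w p 0 (length q)
      period k k< = trans (OccursAt⇒‼ q-at-p k k<) (sym (OccursAt⇒‼ q-at-0 k k<))

      repeat : SameFactor w (i + D) i (length q)
      repeat k k< = trans (OccursAt⇒‼ r-at-i+D k k<ʳ) (sym (OccursAt⇒‼ r-at-i k k<ʳ))
        where k<ʳ = subst (k <_) |q|≡|r| k<

      fits : D + length q ≤ length w
      fits = subst (D + length q ≤_) (sym |w|≡p+|q|)
               (+-monoˡ-≤ (length q) (<⇒≤ (≤-<-trans (m≤n+m D i) i+D<p)))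

lemma5 : {A : Set} (q r w : List A) → q ≢ r → length q ≡ length r →
    IsProperOverlap q w → AtMostOneOccurrence r w
lemma5 q r w q≢r |q|≡|r| (isOverlap , exactlyTwo) with overlap⇒shift isOverlap
... | p , 0<p , p≤|q| , |w|≡p+|q| , q-at-0 , q-at-p = atMostOne
  where
  open Shift |w|≡p+|q| q-at-0 q-at-p

  no-q-inside : ∀ {s} → 0 < s → s < p → ¬ OccursAt q w s
  no-q-inside 0<s s<p q-at-s
    with exactlyTwo⇒≡⊎≡ exactlyTwo q-at-0 q-at-p (<⇒≢ 0<p) q-at-s
  ... | inj₁ refl = <-irrefl refl 0<s
  ... | inj₂ refl = <-irrefl refl s<p

  no-later-occurrence : ∀ {i j} → i < j → OccursAt r w i → ¬ OccursAt r w j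
  no-later-occurrence {i} i<j r-at-i r-at-j
    with m≤n⇒∃[o]m+o≡n (<⇒≤ i<j) | occursAt⇒inside q≢r |q|≡|r| r-at-j
  ... | D , refl | _ , i+D<p =
    no-q-inside (+-cancelˡ-< i 0 D (subst (_< i + D) (sym (+-identityʳ i)) i<j))
                (≤-<-trans (m≤n+m D i) i+D<p)
                (repeat⇒occursAt p≤|q| |q|≡|r| r-at-i r-at-j i+D<p)

  atMostOne : AtMostOneOccurrence r w
  atMostOne i j r-at-i r-at-j with <-cmp i j
  ... | tri< i<j _ _ = ⊥-elim (no-later-occurrence i<j r-at-i r-at-j)
  ... | tri≈ _ i≡j _ = i≡j
  ... | tri> _ _ j<i = ⊥-elim (no-later-occurrence j<i r-at-j r-at-i)
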